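{- Let $p$ be a prime and let $(R,M)$ be a finite commutative local ring whose residue field $k=R/M$ has characteristic $p$. Let $a\in M\setminus M^2$. Then $(a+(R^{\times})^p)\cap (R^{\times})^p=\emptyset$.
   Context: $(R^{\times})^p=\{u^p:u\in R^{\times}\}$ and $a+(R^{\times})^p=\{a+u^p : u\in R^{\times}\}$. -}

module Defs where

open import Level using (Level; _⊔_; suc)
open import Algebra.Bundles using (CommutativeRing; Semiring)
import Algebra.Definitions.RawSemiring as RS
open import Data.Nat.Base using (ℕ)
open import Data.Fin.Base using (Fin)
open import Data.Product using (Σ; ∃; _×_)
open import Data.Sum using (_⊎_)
open import Relation.Nullary using (¬_)

module _ {c ℓ : Level} (R : CommutativeRing c ℓ) where
  open CommutativeRing R
  open RS (Semiring.rawSemiring semiring) using () renaming (_×_ to _·_)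

  pow : Carrier → ℕ → Carrier
  pow = RS._^_ (Semiring.rawSemiring semiring)

  Pred : Set (suc (c ⊔ ℓ))
  Pred = Carrier → Set (c ⊔ ℓ)

  _⊆_ : Pred → Pred → Set (c ⊔ ℓ)
  I ⊆ J = ∀ x → I x → J x

  IsFinite : Set (c ⊔ ℓ)
  IsFinite = Σ ℕ λ n → Σ (Fin n → Carrier) λ f → ∀ x → Σ (Fin n) λ i → f i ≈ x

  IsUnit : Carrier → Set (c ⊔ ℓ)
  IsUnit u = Σ Carrier λ v → u * v ≈ 1#

  record IsIdeal (I : Pred) : Set (c ⊔ ℓ) where
    field
      resp  : ∀ {x y} → x ≈ y → I x → I y
      has0  : I 0#
      add   : ∀ {x y} → I x → I y → I (x + y)
      mulL  : ∀ r {x} → I x → I (r * x)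

  record IsMaximalIdeal (I : Pred) : Set (suc (c ⊔ ℓ)) where
    field
      ideal   : IsIdeal I
      proper  : ¬ I 1#
      maximal : ∀ J → IsIdeal J → I ⊆ J → (J ⊆ I) ⊎ (∀ x → J x)

  record IsLocalRing (M : Pred) : Set (suc (c ⊔ ℓ)) where
    field
      M-maximal : IsMaximalIdeal M
      unique    : ∀ N → IsMaximalIdeal N → (N ⊆ M) × (M ⊆ N)

  data Sq (M : Pred) : Carrier → Set (c ⊔ ℓ) where
    sq-prod : ∀ {x y} → M x → M y → Sq M (x * y)
    sq-zero : Sq M 0#
    sq-add  : ∀ {x y} → Sq M x → Sq M y → Sq M (x + y)
    sq-resp : ∀ {x y} → x ≈ y → Sq M x → Sq M y

  -- the residue field R/M has characteristic p (p prime): p·1 ∈ M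
  ResidueChar : Pred → ℕ → Set (c ⊔ ℓ)
  ResidueChar M p = M (p · 1#)

{-# OPTIONS --safe #-}
module Submission where

-- Put w = v − u. In the binomial expansion of (w + u)ᵖ every middle coefficient is
-- divisible by the prime p, so a + uᵖ = vᵖ becomes a = wᵖ + p·w·z. As p·1 ∈ M this
-- puts wᵖ in M, hence w in M since a maximal ideal is prime; but then wᵖ (p ≥ 2) and
-- p·w·z both lie in M², and so does a.

open import Defs
open import Level using (Level)
open import Algebra.Bundles using (CommutativeRing; CommutativeSemiring)
open import Data.Nat.Base using (ℕ; zero; suc; _∸_; _<_; s≤s; nonTrivial⇒n>1)
import Data.Nat.Base as Nat
import Data.Nat.Properties as Nat
open import Data.Nat.Combinatorics using (_C_; nCn≡1; nC1≡n; nCk+nC[k+1]≡[n+1]C[k+1])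
open import Data.Nat.Divisibility using (_∣_; divides; m∣m*n; >⇒∤)
open import Data.Nat.Primality using (Prime; euclidsLemma; prime⇒nonTrivial)
open import Data.Fin.Base as Fin using (fromℕ)
open import Data.Fin.Properties using (toℕ-fromℕ; inject₁ℕ<)
open import Data.Vec.Functional using (Vector; tail; init)
open import Data.Product using (Σ; ∃; ∃₂; _×_; _,_)
open import Data.Sum using (inj₁; inj₂)
open import Relation.Nullary using (¬_; contradiction)
import Relation.Binary.PropositionalEquality as ≡

[k+1]*[n+1]C[k+1]≡[n+1]*nCk : ∀ n k → suc k Nat.* (suc n C suc k) ≡.≡ suc n Nat.* (n C k)
[k+1]*[n+1]C[k+1]≡[n+1]*nCk zero    zero    = ≡.refl
[k+1]*[n+1]C[k+1]≡[n+1]*nCk zero    (suc k) = Nat.*-zeroʳ (2 Nat.+ k)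
[k+1]*[n+1]C[k+1]≡[n+1]*nCk (suc n) zero    =
  ≡.trans (Nat.*-identityˡ _) (≡.trans (nC1≡n (2 Nat.+ n)) (≡.sym (Nat.*-identityʳ (2 Nat.+ n))))
[k+1]*[n+1]C[k+1]≡[n+1]*nCk (suc n) (suc k) = begin
  (2 + k) * ((2 + n) C (2 + k))    ≡⟨ ≡.cong ((2 + k) *_) (nCk+nC[k+1]≡[n+1]C[k+1] (suc n) (suc k)) ⟨
  (2 + k) * (A + B)                ≡⟨ Nat.*-distribˡ-+ (2 + k) A B ⟩
  (A + (1 + k) * A) + (2 + k) * B  ≡⟨ ≡.cong₂ _+_ (≡.cong (A +_) ([k+1]*[n+1]C[k+1]≡[n+1]*nCk n k))
                                                  ([k+1]*[n+1]C[k+1]≡[n+1]*nCk n (suc k)) ⟩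
  (A + (1 + n) * c) + (1 + n) * d  ≡⟨ Nat.+-assoc A _ _ ⟩
  A + ((1 + n) * c + (1 + n) * d)  ≡⟨ ≡.cong (A +_) (Nat.*-distribˡ-+ (1 + n) c d) ⟨
  A + (1 + n) * (c + d)            ≡⟨ ≡.cong (λ e → A + (1 + n) * e) (nCk+nC[k+1]≡[n+1]C[k+1] n k) ⟩
  A + (1 + n) * A                  ∎
  where
  open import Data.Nat.Base using (_+_; _*_)
  open ≡.≡-Reasoning
  A B c d : ℕ
  A = suc n C suc k
  B = suc n C suc (suc k)
  c = n C k
  d = n C suc k

p∣pC[k+1] : ∀ {p k} → Prime p → suc k < p → p ∣ p C suc k
p∣pC[k+1] {suc n} {k} pp k+1<p with euclidsLemma (suc k) (suc n C suc k) pp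
  (≡.subst (suc n ∣_) (≡.sym ([k+1]*[n+1]C[k+1]≡[n+1]*nCk n k)) (m∣m*n (n C k)))
... | inj₁ p∣k+1 = contradiction p∣k+1 (>⇒∤ k+1<p)
... | inj₂ p∣pC[k+1] = p∣pC[k+1]

module _ {a ℓ} (S : CommutativeSemiring a ℓ) where
  open CommutativeSemiring S hiding (zero)
  open import Algebra.Properties.Semiring.Mult semiring using (×-congʳ; ×-homo-1; ×-assoc-*; ×1-homo-*)
    renaming (_×_ to _·_)
  open import Algebra.Properties.Semiring.Exp semiring using (_^_)
  open import Algebra.Properties.CommutativeSemiring.Binomial S using (theorem; binomialTerm)
  open import Algebra.Properties.Monoid.Sum +-monoid using (sum; sum-init-last)
  open import Algebra.Properties.CommutativeSemigroup *-commutativeSemigroup using (interchange)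
  open import Algebra.Properties.CommutativeSemigroup +-commutativeSemigroup using (x∙yz≈zx∙y)
  open import Relation.Binary.Reasoning.Setoid setoid

  ×≈×1#* : ∀ n x → n · x ≈ (n · 1#) * x
  ×≈×1#* n x = sym (trans (×-assoc-* n 1# x) (×-congʳ n (*-identityˡ x)))

  sum-multiples : ∀ c {n} (f : Vector Carrier n) → (∀ i → ∃ λ z → f i ≈ c * z) →
                  ∃ λ z → sum f ≈ c * z
  sum-multiples c {zero}  f f≈c* = 0# , sym (zeroʳ c)
  sum-multiples c {suc n} f f≈c*
    with f≈c* Fin.zero | sum-multiples c (tail f) (λ i → f≈c* (Fin.suc i))
  ... | z , f₀≈cz | z′ , Σ≈cz′ = z + z′ , trans (+-cong f₀≈cz Σ≈cz′) (sym (distribˡ c z z′))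

  binomialTerm-zero : ∀ x y n → binomialTerm x y n Fin.zero ≈ y ^ n
  binomialTerm-zero x y n = trans (×-homo-1 _) (*-identityˡ _)

  binomialTerm-fromℕ : ∀ x y n → binomialTerm x y n (fromℕ n) ≈ x ^ n
  binomialTerm-fromℕ x y n rewrite toℕ-fromℕ n | nCn≡1 n | Nat.n∸n≡0 n =
    trans (×-homo-1 _) (*-identityʳ _)

  binomialTerm-prime : ∀ {p k} → Prime p → suc k < p → ∀ x y →
                       ∃ λ z → (p C suc k) · (x ^ suc k * y ^ (p ∸ suc k)) ≈ (p · 1#) * x * z
  binomialTerm-prime {p} {k} pp k+1<p x y with p∣pC[k+1] pp k+1<p
  ... | divides q pC[k+1]≡q*p = (q · 1#) * (x ^ k * y ^ (p ∸ suc k)) , (begin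
    (p C suc k) · (x * x ^ k * y ^ (p ∸ suc k))
      ≡⟨ ≡.cong (_· (x * x ^ k * y ^ (p ∸ suc k))) (≡.trans pC[k+1]≡q*p (Nat.*-comm q p)) ⟩
    (p Nat.* q) · (x * x ^ k * y ^ (p ∸ suc k))
      ≈⟨ ×≈×1#* (p Nat.* q) _ ⟩
    ((p Nat.* q) · 1#) * (x * x ^ k * y ^ (p ∸ suc k))
      ≈⟨ *-cong (×1-homo-* p q) (*-assoc x _ _) ⟩
    (p · 1#) * (q · 1#) * (x * (x ^ k * y ^ (p ∸ suc k)))
      ≈⟨ interchange _ _ _ _ ⟩
    (p · 1#) * x * ((q · 1#) * (x ^ k * y ^ (p ∸ suc k))) ∎)

  freshmansDream : ∀ {p} → Prime p → ∀ x y →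
                   ∃ λ z → (x + y) ^ p ≈ (x ^ p + y ^ p) + (p · 1#) * x * z
  freshmansDream {zero} pp = contradiction (nonTrivial⇒n>1 0 {{prime⇒nonTrivial pp}}) λ ()
  freshmansDream {p@(suc n)} pp x y
    with sum-multiples ((p · 1#) * x) (init (tail (binomialTerm x y p)))
           (λ i → binomialTerm-prime pp (s≤s (inject₁ℕ< i)) x y)
  ... | z , middle≈pxz = z , (begin
    (x + y) ^ p
      ≈⟨ theorem p x y ⟩
    binomialTerm x y p Fin.zero + sum (tail (binomialTerm x y p))
      ≈⟨ +-cong (binomialTerm-zero x y p) (sum-init-last (tail (binomialTerm x y p))) ⟩
    y ^ p + (sum (init (tail (binomialTerm x y p))) + binomialTerm x y p (fromℕ p))
      ≈⟨ +-congˡ (+-cong middle≈pxz (binomialTerm-fromℕ x y p)) ⟩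
    y ^ p + ((p · 1#) * x * z + x ^ p)
      ≈⟨ x∙yz≈zx∙y _ _ _ ⟩
    (x ^ p + y ^ p) + (p · 1#) * x * z ∎)

module _ {c ℓ} (R : CommutativeRing c ℓ) where
  open CommutativeRing R
  open import Algebra.Properties.Ring ring using (-1*x≈-x)
  open import Algebra.Properties.Group +-group using (//-rightDividesˡ; ∙-cancelʳ)
  open import Algebra.Properties.CommutativeSemigroup +-commutativeSemigroup using (xy∙z≈xz∙y)
  open import Algebra.Properties.Semiring.Exp semiring using (^-cong)
  open import Algebra.Properties.Semiring.Mult semiring using () renaming (_×_ to _·_)
  open import Algebra.Solver.Ring.NaturalCoefficients.Default commutativeSemiring
  open import Relation.Binary.Reasoning.Setoid setoid

  _+⟨_⟩ : Pred R → Carrier → Pred R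
  (I +⟨ x ⟩) z = ∃₂ λ m r → I m × z ≈ m + r * x

  module _ {I : Pred R} (I-ideal : IsIdeal R I) where
    open IsIdeal I-ideal

    *-closedʳ : ∀ {x} r → I x → I (x * r)
    *-closedʳ {x} r Ix = resp (*-comm r x) (mulL r Ix)

    -‿closed : ∀ {x} → I x → I (- x)
    -‿closed {x} Ix = resp (-1*x≈-x x) (mulL (- 1#) Ix)

    +⟨⟩-isIdeal : ∀ x → IsIdeal R (I +⟨ x ⟩)
    +⟨⟩-isIdeal x = record
      { resp = λ { z≈z′ (m , r , Im , z≈m+rx) → m , r , Im , trans (sym z≈z′) z≈m+rx }
      ; has0 = 0# , 0# , has0 , solve 1 (λ x → con 0 := con 0 :+ con 0 :* x) refl x
      ; add  = λ { (m₁ , r₁ , Im₁ , z₁≈) (m₂ , r₂ , Im₂ , z₂≈) →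
                   m₁ + m₂ , r₁ + r₂ , add Im₁ Im₂ , trans (+-cong z₁≈ z₂≈)
                   (solve 5 (λ m₁ r₁ m₂ r₂ x → (m₁ :+ r₁ :* x) :+ (m₂ :+ r₂ :* x)
                                              := (m₁ :+ m₂) :+ (r₁ :+ r₂) :* x) refl m₁ r₁ m₂ r₂ x) }
      ; mulL = λ { t (m , r , Im , z≈) → t * m , t * r , mulL t Im , trans (*-congˡ z≈)
                   (solve 4 (λ t m r x → t :* (m :+ r :* x) := t :* m :+ (t :* r) :* x) refl t m r x) }
      }

    ^∈Sq : ∀ {x} n → 1 < n → I x → Sq R I (pow R x n)
    ^∈Sq (suc zero)    (s≤s ()) _
    ^∈Sq {x} (suc (suc n)) _ Ix = sq-prod Ix (resp (*-comm _ _) (mulL (pow R x n) Ix))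

  module _ {M : Pred R} (M-maximal : IsMaximalIdeal R M) where
    open IsMaximalIdeal M-maximal
    open IsIdeal ideal

    maximal⇒prime : ∀ {x y} → M (x * y) → ¬ M x → M y
    maximal⇒prime {x} {y} Mxy ¬Mx with maximal (M +⟨ x ⟩) (+⟨⟩-isIdeal ideal x) M⊆M+⟨x⟩
      where
      M⊆M+⟨x⟩ : _⊆_ R M (M +⟨ x ⟩)
      M⊆M+⟨x⟩ z Mz = z , 0# , Mz , solve 2 (λ z x → z := z :+ con 0 :* x) refl z x
    ... | inj₁ M+⟨x⟩⊆M =
      contradiction (M+⟨x⟩⊆M x (0# , 1# , has0 , solve 1 (λ x → x := con 0 :+ con 1 :* x) refl x)) ¬Mx
    ... | inj₂ M+⟨x⟩-total with M+⟨x⟩-total 1#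
    ... | m , r , Mm , 1≈m+rx = resp (sym y≈ym+r[xy]) (add (mulL y Mm) (mulL r Mxy))
      where
      y≈ym+r[xy] : y ≈ y * m + r * (x * y)
      y≈ym+r[xy] = trans (sym (*-identityˡ y)) (trans (*-congʳ 1≈m+rx)
        (solve 4 (λ m r x y → (m :+ r :* x) :* y := y :* m :+ r :* (x :* y)) refl m r x y))

    -- Membership in M is not decidable, so primality only gives ¬ ¬ M x; as the
    -- theorem is a negation, that is enough.
    ^∈⇒¬¬∈ : ∀ {x} n → M (pow R x n) → ¬ ¬ M x
    ^∈⇒¬¬∈ zero    M1   ¬Mx = proper M1
    ^∈⇒¬¬∈ (suc n) Mxⁿ⁺¹ ¬Mx = ^∈⇒¬¬∈ n (maximal⇒prime Mxⁿ⁺¹ ¬Mx) ¬Mx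

  a+uᵖ≈vᵖ⇒a≈[v-u]ᵖ+p[v-u]z : ∀ {p} → Prime p → ∀ {a u v} → a + pow R u p ≈ pow R v p →
                              ∃ λ z → a ≈ pow R (v - u) p + (p · 1#) * (v - u) * z
  a+uᵖ≈vᵖ⇒a≈[v-u]ᵖ+p[v-u]z {p} p-prime {a} {u} {v} a+uᵖ≈vᵖ
    with freshmansDream commutativeSemiring p-prime (v - u) u
  ... | z , [w+u]ᵖ≈wᵖ+uᵖ+pwz = z , ∙-cancelʳ (pow R u p) a (pow R w p + t) (begin
    a + pow R u p              ≈⟨ a+uᵖ≈vᵖ ⟩
    pow R v p                  ≈⟨ ^-cong (//-rightDividesˡ u v) (≡.refl {x = p}) ⟨
    pow R (w + u) p            ≈⟨ [w+u]ᵖ≈wᵖ+uᵖ+pwz ⟩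
    pow R w p + pow R u p + t  ≈⟨ xy∙z≈xz∙y _ _ _ ⟩
    pow R w p + t + pow R u p  ∎)
    where
    w t : Carrier
    w = v - u
    t = (p · 1#) * w * z

proposition4p12 : {c ℓ : Level} (p : ℕ) → Prime p →
    (R : CommutativeRing c ℓ) → IsFinite R →
    (M : Pred R) → IsLocalRing R M → ResidueChar R M p →
    (a : CommutativeRing.Carrier R) → M a → ¬ Sq R M a →
    ¬ (Σ (CommutativeRing.Carrier R) λ u → Σ (CommutativeRing.Carrier R) λ v →
         IsUnit R u × IsUnit R v ×
         CommutativeRing._≈_ R (CommutativeRing._+_ R a (pow R u p))
           (pow R v p))
proposition4p12 p p-prime R _ M local p·1∈M a a∈M a∉M² (u , v , _ , _ , a+uᵖ≈vᵖ)
  with a+uᵖ≈vᵖ⇒a≈[v-u]ᵖ+p[v-u]z R p-prime a+uᵖ≈vᵖ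
... | z , a≈wᵖ+pwz = ^∈⇒¬¬∈ R M-maximal p wᵖ∈M (λ w∈M → a∉M² (a∈M² w∈M))
  where
  open CommutativeRing R
  open IsLocalRing local using (M-maximal)
  open IsMaximalIdeal M-maximal using (ideal)
  open IsIdeal ideal using (resp; add)
  open import Algebra.Properties.Group +-group using (x≈z//y)
  open import Algebra.Properties.Semiring.Mult semiring using () renaming (_×_ to _·_)

  w : Carrier
  w = v - u

  pwz∈M : M ((p · 1#) * w * z)
  pwz∈M = *-closedʳ R ideal z (*-closedʳ R ideal w p·1∈M)

  wᵖ∈M : M (pow R w p)
  wᵖ∈M = resp (sym (x≈z//y _ _ a (sym a≈wᵖ+pwz))) (add a∈M (-‿closed R ideal pwz∈M))

  a∈M² : M w → Sq R M a
  a∈M² w∈M = sq-resp (sym a≈wᵖ+pwz)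
    (sq-add (^∈Sq R ideal p (nonTrivial⇒n>1 p {{prime⇒nonTrivial p-prime}}) w∈M)
            (sq-resp (sym (*-assoc _ w z)) (sq-prod p·1∈M (*-closedʳ R ideal z w∈M))))
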